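{- Let $G=(V,E)$ be a hypergraph and $U\subseteq V$. Then \[ I(G,x)=\sum_{\substack{W\subseteq U\\ W\text{ is independent in } G}} x^{|W|}\cdot I\bigl((G_{\div W})_{ -(U\setminus W)},x\bigr). \]
   Context: A hypergraph $G=(V,E)$ consists of a finite vertex set $V$ and a finite multiset $E$ of non-empty subsets of $V$ (edges). A set $W\subseteq V$ is independent in $G$ if no edge $e\in E$ satisfies $e\subseteq W$. The independence polynomial is $I(G,x)=\sum_{W\subseteq V,\ W\text{ independent}}x^{|W|}$. For $W\subseteq V$ containing no edge, $G_{\div W}$ ("hiding" $W$) is the hypergraph with vertex set $V\setminus W$ and edge multiset $\{e\setminus W: e\in E\}$. For a hypergraph $H$ and a set $S$ of its vertices, $H_{ -S}$ is obtained by deleting the vertices of $S$ together with all edges containing at least one of them. (The paper writes the graph in the sum as $G_{\div W -U}$: first hide $W$, then delete the remaining vertices of $U$.) -}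

module Defs where

open import Data.Nat using (ℕ; zero; suc; _^_)
open import Data.Bool using (true; false)
open import Data.Vec using ([]; _∷_)
open import Data.List using (List; []; _∷_; [_]; map; filter; _++_)
open import Data.Nat.ListAction using (sum)
open import Data.List.Relation.Unary.All using (All; all?)
open import Data.Fin.Subset using (Subset; _⊆_; _∩_; _─_; ∣_∣; Nonempty; Empty; inside; outside)
open import Data.Fin.Subset.Properties using (_⊆?_; nonempty?)
open import Data.Product using (_×_)
open import Relation.Nullary using (¬_; Dec)
open import Relation.Nullary.Decidable using (_×-dec_; ¬?)

-- A (raw) hypergraph whose vertices live in the ambient finite set Fin n:
-- vertex set `verts ⊆ Fin n`, edge multiset `edges` (a list, so repetitions allowed).
record Hypergraph (n : ℕ) : Set where
  constructor hg
  field
    verts : Subset n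
    edges : List (Subset n)
open Hypergraph public

WellFormed : ∀ {n} → Hypergraph n → Set
WellFormed G = All (λ e → Nonempty e × e ⊆ verts G) (edges G)

allSubsets : ∀ n → List (Subset n)
allSubsets zero    = [ [] ]
allSubsets (suc n) = map (outside ∷_) (allSubsets n) ++ map (inside ∷_) (allSubsets n)

Independent : ∀ {n} → Hypergraph n → Subset n → Set
Independent G W = W ⊆ verts G × All (λ e → ¬ (e ⊆ W)) (edges G)

independent? : ∀ {n} (G : Hypergraph n) (W : Subset n) → Dec (Independent G W)
independent? G W = (W ⊆? verts G) ×-dec all? (λ e → ¬? (e ⊆? W)) (edges G)

I : ∀ {n} → Hypergraph n → ℕ → ℕ
I {n} G x = sum (map (λ W → x ^ ∣ W ∣) (filter (independent? G) (allSubsets n)))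

hide : ∀ {n} → Hypergraph n → Subset n → Hypergraph n
hide G W = hg (verts G ─ W) (map (λ e → e ─ W) (edges G))

delete : ∀ {n} → Hypergraph n → Subset n → Hypergraph n
delete H S = hg (verts H ─ S) (filter (λ e → ¬? (nonempty? (e ∩ S))) (edges H))

sumIndepSubsetsOf : ∀ {n} → Hypergraph n → Subset n → (Subset n → ℕ) → ℕ
sumIndepSubsetsOf {n} G U f =
  sum (map f (filter (λ W → (W ⊆? U) ×-dec independent? G W) (allSubsets n)))

-- Every Z ⊆ V splits uniquely as Z = W ∪ Y with W = Z ∩ U and Y = Z ∖ U, and then
-- |Z| = |W| + |Y|.  For such a pair, Z is independent in G iff W is independent in G and
-- Y is independent in G_{÷W−U}: an edge e lies in W ∪ Y iff its trace e ∖ W lies in Y, and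
-- such a trace avoids U, so it is not removed when U ∖ W is deleted.  Summing
-- x^|W| · x^|Y| first over Y and then over W gives the formula.

module Submission where

open import Data.Bool using (Bool; true; false; T; not; _∧_; _∨_)
open import Data.Bool.Properties using (T-∧)
open import Data.Empty using (⊥-elim)
open import Data.Fin.Subset
  using (Subset; _∈_; _∉_; _⊆_; _∪_; _∩_; _─_; ∁; ∣_∣; Nonempty; inside; outside)
open import Data.Fin.Subset.Properties
  using (_∈?_; _⊆?_; nonempty?; drop-∷-⊆; p⊆p∪q; q⊆p∪q; x∈p∪q⁻; x∈p∪q⁺; x∈p∩q⁻;
         x∈p∧x∉q⇒x∈p─q; p─q⊆p; x∈∁p⇒x∉p; x∉p⇒x∈∁p; p⊆q⇒∁p⊇∁q)
open import Data.List using (List; []; _∷_; map; filter; _++_)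
open import Data.List.Properties using (map-++; map-∘; map-cong)
open import Data.List.Relation.Unary.All as All using (All; []; _∷_)
open import Data.List.Relation.Unary.All.Properties using (map⁺; map⁻)
open import Data.Nat using (ℕ; suc; _+_; _*_; _^_)
open import Data.Nat.ListAction using (sum)
open import Data.Nat.ListAction.Properties using (sum-++)
open import Data.Nat.Properties
  using (+-identityʳ; +-suc; *-zeroʳ; *-distribˡ-+; ^-distribˡ-+-*; +-commutativeSemigroup)
open import Algebra.Properties.CommutativeSemigroup +-commutativeSemigroup using (interchange)
open import Data.Product using (_×_; _,_; proj₁; proj₂)
open import Data.Sum using (inj₁; inj₂; [_,_])
open import Data.Vec using ([]; _∷_; here; there)
open import Function using (_∘_; _⇔_; mk⇔; Equivalence)
open import Level using (Level)
open import Relation.Nullary using (¬_; yes; no; does)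
open import Relation.Nullary.Decidable using (T?; ¬?; _×-dec_; does-⇔)
open import Relation.Binary.PropositionalEquality
  using (_≡_; refl; sym; trans; cong; cong₂; module ≡-Reasoning)
open import Relation.Unary using (Pred; Decidable)

open import Defs

open Equivalence using (to; from)
open ≡-Reasoning

private variable
  a p q : Level
  A B : Set a
  n : ℕ

∑ : List A → (A → ℕ) → ℕ
∑ xs f = sum (map f xs)

infix 5 ∑
syntax ∑ xs (λ x → e) = ∑[ x ∈ xs ] e

∑-cong : ∀ (xs : List A) {f g : A → ℕ} → (∀ x → f x ≡ g x) → ∑ xs f ≡ ∑ xs g
∑-cong xs f≗g = cong sum (map-cong f≗g xs)

∑-++ : ∀ (xs ys : List A) (f : A → ℕ) → ∑ (xs ++ ys) f ≡ ∑ xs f + ∑ ys f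
∑-++ xs ys f = trans (cong sum (map-++ f xs ys)) (sum-++ (map f xs) (map f ys))

∑-map : ∀ (g : A → B) (xs : List A) (f : B → ℕ) → ∑ (map g xs) f ≡ ∑ xs (f ∘ g)
∑-map g xs f = cong sum (sym (map-∘ xs))

∑-zero : ∀ (xs : List A) → ∑[ _ ∈ xs ] 0 ≡ 0
∑-zero []       = refl
∑-zero (_ ∷ xs) = ∑-zero xs

∑-+ : ∀ (xs : List A) (f g : A → ℕ) → ∑[ x ∈ xs ] (f x + g x) ≡ ∑ xs f + ∑ xs g
∑-+ []       f g = refl
∑-+ (x ∷ xs) f g =
  trans (cong (f x + g x +_) (∑-+ xs f g)) (interchange (f x) (g x) (∑ xs f) (∑ xs g))

∑-comm : ∀ (xs : List A) (ys : List B) (f : A → B → ℕ) →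
  ∑[ x ∈ xs ] ∑[ y ∈ ys ] f x y ≡ ∑[ y ∈ ys ] ∑[ x ∈ xs ] f x y
∑-comm []       ys f = sym (∑-zero ys)
∑-comm (x ∷ xs) ys f =
  trans (cong (∑ ys (f x) +_) (∑-comm xs ys f)) (sym (∑-+ ys (f x) _))

*-distribˡ-∑ : ∀ k (xs : List A) (f : A → ℕ) → k * ∑ xs f ≡ ∑[ x ∈ xs ] k * f x
*-distribˡ-∑ k []       f = *-zeroʳ k
*-distribˡ-∑ k (x ∷ xs) f =
  trans (*-distribˡ-+ k (f x) (∑ xs f)) (cong (k * f x +_) (*-distribˡ-∑ k xs f))

guard : Bool → ℕ → ℕ
guard true  m = m
guard false _ = 0

guard-∧ : ∀ b c m → guard (b ∧ c) m ≡ guard b (guard c m)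
guard-∧ true  c m = refl
guard-∧ false c m = refl

*-guard : ∀ k b m → k * guard b m ≡ guard b (k * m)
*-guard k true  m = refl
*-guard k false m = *-zeroʳ k

guard-cong : ∀ b {m m′} → (T b → m ≡ m′) → guard b m ≡ guard b m′
guard-cong true  eq = eq _
guard-cong false eq = refl

guard-∑ : ∀ b (xs : List A) (f : A → ℕ) → guard b (∑ xs f) ≡ ∑[ x ∈ xs ] guard b (f x)
guard-∑ true  xs f = refl
guard-∑ false xs f = sym (∑-zero xs)

∑-filter : ∀ {P : Pred A p} (P? : Decidable P) (xs : List A) (f : A → ℕ) →
  ∑ (filter P? xs) f ≡ ∑[ x ∈ xs ] guard (does (P? x)) (f x)
∑-filter P? []       f = refl
∑-filter P? (x ∷ xs) f with does (P? x)
... | true  = cong (f x +_) (∑-filter P? xs f)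
... | false = ∑-filter P? xs f

bits : List Bool
bits = outside ∷ inside ∷ []

∑-allSubsets-suc : ∀ (g : Subset (suc n) → ℕ) →
  ∑ (allSubsets (suc n)) g ≡ ∑[ b ∈ bits ] ∑[ W ∈ allSubsets n ] g (b ∷ W)
∑-allSubsets-suc {n} g = begin
  ∑ (map (outside ∷_) 𝒫 ++ map (inside ∷_) 𝒫) g
    ≡⟨ ∑-++ (map (outside ∷_) 𝒫) _ g ⟩
  ∑ (map (outside ∷_) 𝒫) g + ∑ (map (inside ∷_) 𝒫) g
    ≡⟨ cong₂ _+_ (∑-map (outside ∷_) 𝒫 g) (∑-map (inside ∷_) 𝒫 g) ⟩
  (∑[ W ∈ 𝒫 ] g (outside ∷ W)) + (∑[ W ∈ 𝒫 ] g (inside ∷ W))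
    ≡⟨ cong (∑ 𝒫 (g ∘ (outside ∷_)) +_) (sym (+-identityʳ _)) ⟩
  ∑[ b ∈ bits ] ∑[ W ∈ 𝒫 ] g (b ∷ W) ∎
  where 𝒫 = allSubsets n

∑²-allSubsets-suc : ∀ (h : Subset (suc n) → Subset (suc n) → ℕ) →
  ∑[ W′ ∈ allSubsets (suc n) ] ∑[ Y′ ∈ allSubsets (suc n) ] h W′ Y′
    ≡ ∑[ w ∈ bits ] ∑[ y ∈ bits ] ∑[ W ∈ allSubsets n ] ∑[ Y ∈ allSubsets n ] h (w ∷ W) (y ∷ Y)
∑²-allSubsets-suc {n} h = begin
  ∑[ W′ ∈ allSubsets (suc n) ] ∑[ Y′ ∈ allSubsets (suc n) ] h W′ Y′
    ≡⟨ ∑-allSubsets-suc (λ W′ → ∑ (allSubsets (suc n)) (h W′)) ⟩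
  ∑[ w ∈ bits ] ∑[ W ∈ 𝒫 ] ∑[ Y′ ∈ allSubsets (suc n) ] h (w ∷ W) Y′
    ≡⟨ ∑-cong bits (λ w → ∑-cong 𝒫 (λ W → ∑-allSubsets-suc (h (w ∷ W)))) ⟩
  ∑[ w ∈ bits ] ∑[ W ∈ 𝒫 ] ∑[ y ∈ bits ] ∑[ Y ∈ 𝒫 ] h (w ∷ W) (y ∷ Y)
    ≡⟨ ∑-cong bits (λ w → ∑-comm 𝒫 bits (λ W y → ∑[ Y ∈ 𝒫 ] h (w ∷ W) (y ∷ Y))) ⟩
  ∑[ w ∈ bits ] ∑[ y ∈ bits ] ∑[ W ∈ 𝒫 ] ∑[ Y ∈ 𝒫 ] h (w ∷ W) (y ∷ Y) ∎
  where 𝒫 = allSubsets n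

splitᵇ : Bool → Bool → Bool → Bool
splitᵇ inside  w y = not y
splitᵇ outside w y = not w

-- W ⊆ U × Y ⊆ ∁ U (isSplit⇔), computed coordinatewise so that guarded sums over
-- allSubsets (suc n) unfold one coordinate at a time.
isSplit : Subset n → Subset n → Subset n → Bool
isSplit []      []      []      = true
isSplit (u ∷ U) (w ∷ W) (y ∷ Y) = splitᵇ u w y ∧ isSplit U W Y

isSplit⇔ : ∀ (U W Y : Subset n) → T (isSplit U W Y) ⇔ (W ⊆ U × Y ⊆ ∁ U)
isSplit⇔ U W Y = mk⇔ (sound U W Y) (complete U W Y)
  where
  sound : ∀ {n} (U W Y : Subset n) → T (isSplit U W Y) → W ⊆ U × Y ⊆ ∁ U
  sound []             []             []             _ = (λ ()) , (λ ())
  sound (inside ∷ U)   (w ∷ W)        (outside ∷ Y)  t with sound U W Y t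
  ... | W⊆U , Y⊆∁U =
    (λ { here → here ; (there i) → there (W⊆U i) }) , (λ { (there i) → there (Y⊆∁U i) })
  sound (outside ∷ U)  (outside ∷ W)  (y ∷ Y)        t with sound U W Y t
  ... | W⊆U , Y⊆∁U =
    (λ { (there i) → there (W⊆U i) }) , (λ { here → here ; (there i) → there (Y⊆∁U i) })
  complete : ∀ {n} (U W Y : Subset n) → W ⊆ U × Y ⊆ ∁ U → T (isSplit U W Y)
  complete []            []            []            _ = _
  complete (inside ∷ U)  (w ∷ W)       (outside ∷ Y) (W⊆U , Y⊆∁U) =
    complete U W Y (drop-∷-⊆ W⊆U , drop-∷-⊆ Y⊆∁U)
  complete (inside ∷ U)  (w ∷ W)       (inside ∷ Y)  (_ , Y⊆∁U) with () ← Y⊆∁U here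
  complete (outside ∷ U) (outside ∷ W) (y ∷ Y)       (W⊆U , Y⊆∁U) =
    complete U W Y (drop-∷-⊆ W⊆U , drop-∷-⊆ Y⊆∁U)
  complete (outside ∷ U) (inside ∷ W)  (y ∷ Y)       (W⊆U , _) with () ← W⊆U here

∣∪∣-isSplit : ∀ (U W Y : Subset n) → T (isSplit U W Y) → ∣ W ∪ Y ∣ ≡ ∣ W ∣ + ∣ Y ∣
∣∪∣-isSplit []            []            []            _ = refl
∣∪∣-isSplit (inside ∷ U)  (inside ∷ W)  (outside ∷ Y) t = cong suc (∣∪∣-isSplit U W Y t)
∣∪∣-isSplit (inside ∷ U)  (outside ∷ W) (outside ∷ Y) t = ∣∪∣-isSplit U W Y t
∣∪∣-isSplit (outside ∷ U) (outside ∷ W) (inside ∷ Y)  t =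
  trans (cong suc (∣∪∣-isSplit U W Y t)) (sym (+-suc ∣ W ∣ ∣ Y ∣))
∣∪∣-isSplit (outside ∷ U) (outside ∷ W) (outside ∷ Y) t = ∣∪∣-isSplit U W Y t

∑-bits-split : ∀ u (t : Bool → ℕ) →
  ∑[ b ∈ bits ] t b ≡ ∑[ w ∈ bits ] ∑[ y ∈ bits ] guard (splitᵇ u w y) (t (w ∨ y))
∑-bits-split inside  t =
  cong₂ _+_ (sym (+-identityʳ (t outside))) (sym (+-identityʳ (t inside + 0)))
∑-bits-split outside t = sym (+-identityʳ (∑ bits t))

∑-allSubsets-split : ∀ (U : Subset n) (F : Subset n → ℕ) →
  ∑ (allSubsets n) F ≡ ∑[ W ∈ allSubsets n ] ∑[ Y ∈ allSubsets n ] guard (isSplit U W Y) (F (W ∪ Y))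
∑-allSubsets-split []      F = sym (+-identityʳ _)
∑-allSubsets-split {suc n} (u ∷ U) F = begin
  ∑ (allSubsets (suc n)) F
    ≡⟨ ∑-allSubsets-suc F ⟩
  ∑[ b ∈ bits ] ∑[ Z ∈ 𝒫 ] F (b ∷ Z)
    ≡⟨ ∑-cong bits (λ b → ∑-allSubsets-split U (F ∘ (b ∷_))) ⟩
  ∑[ b ∈ bits ] t b
    ≡⟨ ∑-bits-split u t ⟩
  ∑[ w ∈ bits ] ∑[ y ∈ bits ] guard (splitᵇ u w y) (t (w ∨ y))
    ≡⟨ ∑-cong bits (λ w → ∑-cong bits (λ y → guard-∑² (splitᵇ u w y) (w ∨ y))) ⟩
  ∑[ w ∈ bits ] ∑[ y ∈ bits ] ∑[ W ∈ 𝒫 ] ∑[ Y ∈ 𝒫 ]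
    guard (isSplit (u ∷ U) (w ∷ W) (y ∷ Y)) (F ((w ∷ W) ∪ (y ∷ Y)))
    ≡⟨ sym (∑²-allSubsets-suc (λ W′ Y′ → guard (isSplit (u ∷ U) W′ Y′) (F (W′ ∪ Y′)))) ⟩
  ∑[ W′ ∈ allSubsets (suc n) ] ∑[ Y′ ∈ allSubsets (suc n) ]
    guard (isSplit (u ∷ U) W′ Y′) (F (W′ ∪ Y′)) ∎
  where
  𝒫 = allSubsets n
  t : Bool → ℕ
  t b = ∑[ W ∈ 𝒫 ] ∑[ Y ∈ 𝒫 ] guard (isSplit U W Y) (F (b ∷ (W ∪ Y)))
  guard-∑² : ∀ s b →
    guard s (t b) ≡ ∑[ W ∈ 𝒫 ] ∑[ Y ∈ 𝒫 ] guard (s ∧ isSplit U W Y) (F (b ∷ (W ∪ Y)))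
  guard-∑² s b = trans (guard-∑ s 𝒫 _) (∑-cong 𝒫 (λ W →
    trans (guard-∑ s 𝒫 _) (∑-cong 𝒫 (λ Y → sym (guard-∧ s (isSplit U W Y) _)))))

x∈p─q⇒x∉q : ∀ {p q : Subset n} {x} → x ∈ p ─ q → x ∉ q
x∈p─q⇒x∉q {p = inside ∷ _} {outside ∷ _} here ()
x∈p─q⇒x∉q {p = _ ∷ _}      {_ ∷ _}       (there x∈p─q) (there x∈q) = x∈p─q⇒x∉q x∈p─q x∈q

p─q⊆r⇔p⊆q∪r : ∀ {p q r : Subset n} → p ─ q ⊆ r ⇔ p ⊆ q ∪ r
p─q⊆r⇔p⊆q∪r {p = p} {q} {r} = mk⇔ to′ from′
  where
  to′ : p ─ q ⊆ r → p ⊆ q ∪ r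
  to′ p─q⊆r {x} x∈p with x ∈? q
  ... | yes x∈q = x∈p∪q⁺ (inj₁ x∈q)
  ... | no  x∉q = x∈p∪q⁺ (inj₂ (p─q⊆r (x∈p∧x∉q⇒x∈p─q x∈p x∉q)))
  from′ : p ⊆ q ∪ r → p ─ q ⊆ r
  from′ p⊆q∪r x∈p─q with x∈p∪q⁻ q r (p⊆q∪r (p─q⊆p p q x∈p─q))
  ... | inj₁ x∈q = ⊥-elim (x∈p─q⇒x∉q x∈p─q x∈q)
  ... | inj₂ x∈r = x∈r

p⊆∁q⇒p∩q≡∅ : ∀ {p q : Subset n} → p ⊆ ∁ q → ¬ Nonempty (p ∩ q)
p⊆∁q⇒p∩q≡∅ {p = p} {q} p⊆∁q (x , x∈p∩q) with x∈p∩q⁻ p q x∈p∩q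
... | x∈p , x∈q = x∈∁p⇒x∉p (p⊆∁q x∈p) x∈q

All-filter⇔ : ∀ {P : Pred A p} {Q : Pred A q} (Q? : Decidable Q) (xs : List A) →
  All P (filter Q? xs) ⇔ All (λ x → Q x → P x) xs
All-filter⇔ {P = P} {Q} Q? xs = mk⇔ (to′ xs) (from′ xs)
  where
  to′ : ∀ xs → All P (filter Q? xs) → All (λ x → Q x → P x) xs
  to′ []       _ = []
  to′ (x ∷ xs) ps with Q? x
  to′ (x ∷ xs) (px ∷ ps) | yes _  = (λ _ → px) ∷ to′ xs ps
  to′ (x ∷ xs) ps        | no ¬qx = (λ qx → ⊥-elim (¬qx qx)) ∷ to′ xs ps
  from′ : ∀ xs → All (λ x → Q x → P x) xs → All P (filter Q? xs)
  from′ []       []         = []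
  from′ (x ∷ xs) (qx⇒px ∷ h) with Q? x
  ... | yes qx = qx⇒px qx ∷ from′ xs h
  ... | no  _  = from′ xs h

residual : Hypergraph n → Subset n → Subset n → Hypergraph n
residual G U W = delete (hide G W) (U ─ W)

independent-⊆ : ∀ (G : Hypergraph n) {W Z} → W ⊆ Z → Independent G Z → Independent G W
independent-⊆ G W⊆Z (Z⊆V , uncovered) =
  (λ x∈W → Z⊆V (W⊆Z x∈W)) , All.map (λ e⊈Z e⊆W → e⊈Z (λ x∈e → W⊆Z (e⊆W x∈e))) uncovered

module _ (G : Hypergraph n) {U W : Subset n} where

  ∈-residual⁻ : ∀ {x} → x ∈ verts (residual G U W) → x ∈ verts G × x ∉ U
  ∈-residual⁻ x∈V′ =
    p─q⊆p _ W x∈V─W ,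
    λ x∈U → x∈p─q⇒x∉q x∈V′ (x∈p∧x∉q⇒x∈p─q x∈U (x∈p─q⇒x∉q x∈V─W))
    where x∈V─W = p─q⊆p _ _ x∈V′

  ∈-residual⁺ : ∀ {x} → W ⊆ U → x ∈ verts G → x ∉ U → x ∈ verts (residual G U W)
  ∈-residual⁺ W⊆U x∈V x∉U =
    x∈p∧x∉q⇒x∈p─q (x∈p∧x∉q⇒x∈p─q x∈V (x∉U ∘ W⊆U)) (x∉U ∘ p─q⊆p U W)

  independent-residual⇒⊆∁ : ∀ {Y} → Independent (residual G U W) Y → Y ⊆ ∁ U
  independent-residual⇒⊆∁ (Y⊆V′ , _) x∈Y = x∉p⇒x∈∁p (proj₂ (∈-residual⁻ (Y⊆V′ x∈Y)))

  uncovered-residual⇔ : ∀ {Y} → Y ⊆ ∁ U →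
    All (λ e → ¬ e ⊆ W ∪ Y) (edges G) ⇔ All (λ f → ¬ f ⊆ Y) (edges (residual G U W))
  uncovered-residual⇔ {Y} Y⊆∁U = mk⇔
    (from (All-filter⇔ survives? (map (_─ W) (edges G))) ∘ map⁺ ∘ All.map trace-uncovered)
    (All.map uncovered-trace ∘ map⁻ ∘ to (All-filter⇔ survives? (map (_─ W) (edges G))))
    where
    Survives : Subset n → Set
    Survives f = ¬ Nonempty (f ∩ (U ─ W))
    survives? : Decidable Survives
    survives? f = ¬? (nonempty? (f ∩ (U ─ W)))
    trace-uncovered : ∀ {e} → ¬ e ⊆ W ∪ Y → Survives (e ─ W) → ¬ e ─ W ⊆ Y
    trace-uncovered {e} e⊈W∪Y _ e─W⊆Y = e⊈W∪Y (to (p─q⊆r⇔p⊆q∪r {p = e} {W} {Y}) e─W⊆Y)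
    uncovered-trace : ∀ {e} → (Survives (e ─ W) → ¬ e ─ W ⊆ Y) → ¬ e ⊆ W ∪ Y
    uncovered-trace {e} h e⊆W∪Y = h (p⊆∁q⇒p∩q≡∅ e─W⊆∁[U─W]) e─W⊆Y
      where
      e─W⊆Y : e ─ W ⊆ Y
      e─W⊆Y = from (p─q⊆r⇔p⊆q∪r {p = e} {W} {Y}) e⊆W∪Y
      e─W⊆∁[U─W] : e ─ W ⊆ ∁ (U ─ W)
      e─W⊆∁[U─W] x∈e─W = p⊆q⇒∁p⊇∁q (p─q⊆p U W) (Y⊆∁U (e─W⊆Y x∈e─W))

  independent-∪⇔ : ∀ {Y} → W ⊆ U → Y ⊆ ∁ U →
    Independent G (W ∪ Y) ⇔ (Independent G W × Independent (residual G U W) Y)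
  independent-∪⇔ {Y} W⊆U Y⊆∁U = mk⇔
    (λ indep@(W∪Y⊆V , uncovered) →
      independent-⊆ G (p⊆p∪q Y) indep ,
      (λ x∈Y → ∈-residual⁺ W⊆U (W∪Y⊆V (q⊆p∪q W Y x∈Y)) (x∈∁p⇒x∉p (Y⊆∁U x∈Y))) ,
      to (uncovered-residual⇔ Y⊆∁U) uncovered)
    (λ ((W⊆V , _) , (Y⊆V′ , uncovered′)) →
      (λ x∈W∪Y → [ W⊆V , proj₁ ∘ ∈-residual⁻ ∘ Y⊆V′ ] (x∈p∪q⁻ W Y x∈W∪Y)) ,
      from (uncovered-residual⇔ Y⊆∁U) uncovered′)

  isSplit×independent⇔ : ∀ {Y} →
    (T (isSplit U W Y) × Independent G (W ∪ Y))
      ⇔ ((W ⊆ U × Independent G W) × Independent (residual G U W) Y)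
  isSplit×independent⇔ {Y} = mk⇔
    (λ (split , indep) → let W⊆U , Y⊆∁U = to (isSplit⇔ U W Y) split
                             indepW , indepY = to (independent-∪⇔ W⊆U Y⊆∁U) indep
                         in (W⊆U , indepW) , indepY)
    (λ ((W⊆U , indepW) , indepY) → let Y⊆∁U = independent-residual⇒⊆∁ indepY in
      from (isSplit⇔ U W Y) (W⊆U , Y⊆∁U) , from (independent-∪⇔ W⊆U Y⊆∁U) (indepW , indepY))

  ∑-isSplit-independent : ∀ x →
    ∑[ Y ∈ allSubsets n ]
      guard (isSplit U W Y) (guard (does (independent? G (W ∪ Y))) (x ^ ∣ W ∪ Y ∣))
      ≡ guard (does (W ⊆? U ×-dec independent? G W)) (x ^ ∣ W ∣ * I (residual G U W) x)
  ∑-isSplit-independent x = begin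
    ∑[ Y ∈ 𝒫 ] guard (isSplit U W Y) (guard (inG Y) (x ^ ∣ W ∪ Y ∣))
      ≡⟨ ∑-cong 𝒫 (λ Y → sym (guard-∧ (isSplit U W Y) (inG Y) _)) ⟩
    ∑[ Y ∈ 𝒫 ] guard (isSplit U W Y ∧ inG Y) (x ^ ∣ W ∪ Y ∣)
      ≡⟨ ∑-cong 𝒫 term ⟩
    ∑[ Y ∈ 𝒫 ] guard (inU ∧ inH Y) (x ^ ∣ W ∣ * x ^ ∣ Y ∣)
      ≡⟨ ∑-cong 𝒫 (λ Y → trans (guard-∧ inU (inH Y) _)
           (cong (guard inU) (sym (*-guard (x ^ ∣ W ∣) (inH Y) (x ^ ∣ Y ∣))))) ⟩
    ∑[ Y ∈ 𝒫 ] guard inU (x ^ ∣ W ∣ * guard (inH Y) (x ^ ∣ Y ∣))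
      ≡⟨ sym (guard-∑ inU 𝒫 _) ⟩
    guard inU (∑[ Y ∈ 𝒫 ] x ^ ∣ W ∣ * guard (inH Y) (x ^ ∣ Y ∣))
      ≡⟨ cong (guard inU) (sym (*-distribˡ-∑ (x ^ ∣ W ∣) 𝒫 _)) ⟩
    guard inU (x ^ ∣ W ∣ * (∑[ Y ∈ 𝒫 ] guard (inH Y) (x ^ ∣ Y ∣)))
      ≡⟨ cong (λ s → guard inU (x ^ ∣ W ∣ * s)) (sym (∑-filter (independent? H) 𝒫 _)) ⟩
    guard inU (x ^ ∣ W ∣ * I H x) ∎
    where
    𝒫 = allSubsets n
    H = residual G U W
    inG : Subset n → Bool
    inG Y = does (independent? G (W ∪ Y))
    inU? = W ⊆? U ×-dec independent? G W
    inU : Bool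
    inU = does inU?
    inH : Subset n → Bool
    inH Y = does (independent? H Y)
    term : ∀ Y →
      guard (isSplit U W Y ∧ inG Y) (x ^ ∣ W ∪ Y ∣) ≡ guard (inU ∧ inH Y) (x ^ ∣ W ∣ * x ^ ∣ Y ∣)
    term Y = begin
      guard (isSplit U W Y ∧ inG Y) (x ^ ∣ W ∪ Y ∣)
        ≡⟨ guard-cong (isSplit U W Y ∧ inG Y) (λ t →
             trans (cong (x ^_) (∣∪∣-isSplit U W Y (proj₁ (to T-∧ t))))
                   (^-distribˡ-+-* x ∣ W ∣ ∣ Y ∣)) ⟩
      guard (isSplit U W Y ∧ inG Y) (x ^ ∣ W ∣ * x ^ ∣ Y ∣)
        ≡⟨ cong (λ b → guard b _)
             (does-⇔ isSplit×independent⇔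
               (T? (isSplit U W Y) ×-dec independent? G (W ∪ Y)) (inU? ×-dec independent? H Y)) ⟩
      guard (inU ∧ inH Y) (x ^ ∣ W ∣ * x ^ ∣ Y ∣) ∎

mainTheorem4 : ∀ {n} (G : Hypergraph n) → WellFormed G → (U : Subset n) → U ⊆ verts G →
    (x : ℕ) → I G x ≡ sumIndepSubsetsOf G U (λ W → x ^ ∣ W ∣ * I (delete (hide G W) (U ─ W)) x)
mainTheorem4 {n} G _ U _ x = begin
  I G x
    ≡⟨ ∑-filter (independent? G) 𝒫 _ ⟩
  ∑[ Z ∈ 𝒫 ] guard (does (independent? G Z)) (x ^ ∣ Z ∣)
    ≡⟨ ∑-allSubsets-split U _ ⟩
  ∑[ W ∈ 𝒫 ] ∑[ Y ∈ 𝒫 ]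
    guard (isSplit U W Y) (guard (does (independent? G (W ∪ Y))) (x ^ ∣ W ∪ Y ∣))
    ≡⟨ ∑-cong 𝒫 (λ W → ∑-isSplit-independent G {U} {W} x) ⟩
  ∑[ W ∈ 𝒫 ] guard (does (W ⊆? U ×-dec independent? G W)) (x ^ ∣ W ∣ * I (residual G U W) x)
    ≡⟨ sym (∑-filter (λ W → W ⊆? U ×-dec independent? G W) 𝒫 _) ⟩
  sumIndepSubsetsOf G U (λ W → x ^ ∣ W ∣ * I (residual G U W) x) ∎
  where 𝒫 = allSubsets n
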